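{- For all compositions $\alpha,\beta$ of $n$ and $N\ge n$, the coefficient of $G_\beta(x_1,\ldots,x_N;t)$ in the expansion of $F_\alpha(x_1,\ldots,x_N)$ in the basis $\{G_\gamma\}_{\gamma}$ is $t^{g(\alpha,\beta)}$ if $\beta\succeq\alpha$ and $0$ otherwise; that is, $F_\alpha=\sum_{\beta\succeq\alpha}t^{g(\alpha,\beta)}G_\beta$.
   Context: For a composition $\alpha=(\alpha_1,\ldots,\alpha_k)$ of $n$, $\ell(\alpha)=k$ and $\mathrm{sub}(\alpha)=\{\alpha_1,\alpha_1+\alpha_2,\ldots,\alpha_1+\cdots+\alpha_{k-1}\}\subseteq[n-1]$. Write $\beta\succeq\alpha$ ($\beta$ finer than $\alpha$) iff $\mathrm{sub}(\alpha)\subseteq\mathrm{sub}(\beta)$. If $\beta\succeq\alpha$ with $\ell(\beta)=m$, there are indices $0=i_0<i_1<\dots<i_k=m$ with $\alpha_j=\beta_{i_{j-1}+1}+\dots+\beta_{i_j}$; set $s(\alpha,\beta)=\sum_{j=1}^k j(i_j-i_{j-1}-1)$. For $1\le j\le \ell(\beta)-1$ let $\xi_{\alpha,\beta}(j)=j$ if $\beta_j$ and $\beta_{j+1}$ are formed from the same part of $\alpha$ (i.e. $\beta_1+\dots+\beta_j\notin\mathrm{sub}(\alpha)$) and $0$ otherwise; $g(\alpha,\beta)=\sum_{j=1}^{\ell(\beta)-1}\xi_{\alpha,\beta}(j)$. $F_\alpha(x_1,\ldots,x_N)=\sum x_{w_1}\cdots x_{w_n}$ over $1\le w_1\le\dots\le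 w_n\le N$ with $w_j<w_{j+1}$ for $j\in\mathrm{sub}(\alpha)$ (Gessel's fundamental quasisymmetric polynomials, a basis of degree-$n$ quasisymmetric polynomials for $N\ge n$). Hivert's quasisymmetric Hall–Littlewood polynomials satisfy (and may be taken to be defined by) $G_\alpha(x_1,\ldots,x_N;t)=\sum_{\beta\succeq\alpha}(-1)^{\ell(\beta)-\ell(\alpha)}t^{s(\alpha,\beta)}F_\beta(x_1,\ldots,x_N)$. -}

module Defs where

open import Level using (Level)
open import Data.Bool using (Bool; true; false; _∧_; not; if_then_else_)
open import Data.Nat using (ℕ; zero; suc; _+_; _*_; _∸_; _≤ᵇ_; _<ᵇ_; _≡ᵇ_; _<_)
open import Data.Fin using (Fin; toℕ)
open import Data.List using (List; []; _∷_; [_]; map; concatMap; filterᵇ; length; foldr; allFin)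
open import Data.Nat.ListAction using (sum)
open import Data.Bool.ListAction using (any)
open import Data.List.Relation.Unary.All using (All)
open import Data.Product using (_×_)
open import Relation.Binary.PropositionalEquality using (_≡_)
open import Algebra.Bundles using (CommutativeRing)

IsComposition : ℕ → List ℕ → Set
IsComposition n α = All (λ a → 0 < a) α × sum α ≡ n

-- Enumeration of all compositions of n (each exactly once):
-- a composition of n+1 arises from one of n either by prepending a
-- new part 1 or by increasing the first part by 1.
compositions : ℕ → List (List ℕ)
compositions zero = [ [] ]
compositions (suc n) = concatMap ext (compositions n)
  where
  ext : List ℕ → List (List ℕ)
  ext [] = [ 1 ∷ [] ]
  ext (a ∷ c) = (1 ∷ a ∷ c) ∷ (suc a ∷ c) ∷ []

psumsFrom : ℕ → List ℕ → List ℕ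
psumsFrom acc [] = []
psumsFrom acc (a ∷ as) = (acc + a) ∷ psumsFrom (acc + a) as

psums : List ℕ → List ℕ
psums = psumsFrom 0

dropLast : List ℕ → List ℕ
dropLast [] = []
dropLast (x ∷ []) = []
dropLast (x ∷ y ∷ xs) = x ∷ dropLast (y ∷ xs)

sub : List ℕ → List ℕ
sub α = dropLast (psums α)

_∈ᵇ_ : ℕ → List ℕ → Bool
x ∈ᵇ xs = any (x ≡ᵇ_) xs

_⊆ᵇ_ : List ℕ → List ℕ → Bool
xs ⊆ᵇ ys = foldr (λ x b → (x ∈ᵇ ys) ∧ b) true xs

_⪰ᵇ_ : List ℕ → List ℕ → Bool
β ⪰ᵇ α = sub α ⊆ᵇ sub β

count≤ : ℕ → List ℕ → ℕ
count≤ a [] = 0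
count≤ a (p ∷ ps) = if p ≤ᵇ a then suc (count≤ a ps) else count≤ a ps

-- i_j = number of partial sums β₁+⋯+β_i (1 ≤ i ≤ ℓ(β)) that are ≤ α₁+⋯+α_j;
-- for β ⪰ α this is the unique index with β₁+⋯+β_{i_j} = α₁+⋯+α_j.
-- sAux j i_{j-1} (α-partial sums from j on) (β-partial sums)
--   = Σ_{j' ≥ j} j' (i_{j'} - i_{j'-1} - 1)
sAux : ℕ → ℕ → List ℕ → List ℕ → ℕ
sAux j iprev [] pβ = 0
sAux j iprev (a ∷ as) pβ =
  let i = count≤ a pβ in j * (i ∸ iprev ∸ 1) + sAux (suc j) i as pβ

s : List ℕ → List ℕ → ℕ
s α β = sAux 1 0 (psums α) (psums β)

gAux : ℕ → List ℕ → List ℕ → ℕ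
gAux j S [] = 0
gAux j S (p ∷ ps) = (if p ∈ᵇ S then 0 else j) + gAux (suc j) S ps

g : List ℕ → List ℕ → ℕ
g α β = gAux 1 (sub α) (sub β)

module Poly {c ℓ : Level} (R : CommutativeRing c ℓ) where
  open CommutativeRing R renaming (_+_ to _⊕_; _*_ to _⊗_)

  Σ[_] : List Carrier → Carrier
  Σ[ xs ] = foldr _⊕_ 0# xs

  Π[_] : List Carrier → Carrier
  Π[ xs ] = foldr _⊗_ 1# xs

  pow : Carrier → ℕ → Carrier
  pow x zero = 1#
  pow x (suc k) = x ⊗ pow x k

  sign : ℕ → Carrier
  sign zero = 1#
  sign (suc k) = - sign k

  words : (N n : ℕ) → List (List (Fin N))
  words N zero = [ [] ]
  words N (suc n) = concatMap (λ i → map (i ∷_) (words N n)) (allFin N)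

  okAux : {N : ℕ} → ℕ → List ℕ → List (Fin N) → Bool
  okAux j S [] = true
  okAux j S (a ∷ []) = true
  okAux j S (a ∷ b ∷ w) =
    (if j ∈ᵇ S then toℕ a <ᵇ toℕ b else toℕ a ≤ᵇ toℕ b) ∧ okAux (suc j) S (b ∷ w)

  F : (N : ℕ) → List ℕ → (Fin N → Carrier) → Carrier
  F N α x = Σ[ map (λ w → Π[ map x w ]) (filterᵇ (okAux 1 (sub α)) (words N (sum α))) ]

  G : (N : ℕ) → List ℕ → (Fin N → Carrier) → Carrier → Carrier
  G N α x t =
    Σ[ map (λ β → sign (length β ∸ length α) ⊗ (pow t (s α β) ⊗ F N β x))
           (filterᵇ (_⪰ᵇ α) (compositions (sum α))) ]

-- Compositions of k + 1 correspond to subsets of the k cut positions, and β ⪰ α to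
-- inclusion. Writing G_β = Σ_{γ ⪰ β} S(β,γ) F_γ, the claim is that the matrix
-- M(α,β) = [β ⪰ α] t^{g(α,β)} is inverse to S. Reading the cut positions from left
-- to right, with c one more than the number of cuts of β passed so far, g and s
-- become sums of local contributions and (M S)(α,γ) factors position by position:
-- where γ cuts and α does not, a cut of β contributes t^c through g and no cut
-- contributes −t^c through s, so the two cancel; elsewhere the choice for β is forced.
module Submission where

open import Defs
open import Level using (Level)
open import Data.Bool using (Bool; true; false; if_then_else_)
open import Data.Nat using (ℕ; zero; suc; _+_; _∸_; _≤_)
open import Data.Fin using (Fin)
open import Data.List using (List; []; _∷_; map; concatMap; filterᵇ; length)
open import Data.Vec using (Vec; []; _∷_)
open import Data.List.Relation.Unary.All using (_∷_)
open import Data.Product using (_,_)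
open import Relation.Binary.PropositionalEquality as ≡ using (_≡_)
open import Algebra.Bundles using (CommutativeRing)

module Cuts where

  open import Data.Bool using (_∧_; _∨_)
  open import Data.Nat using (_*_; _<_; z≤n; s≤s)
  open import Data.Nat.Properties
    using (suc-injective; _≟_; _≤?_; ≤-refl; <-trans; n<1+n; m≤n⇒m≤1+n; <⇒≤; <⇒≢; >⇒≢; <⇒≱;
           m+n∸m≡n)
  import Data.Nat.Properties as ℕ
  open import Data.Nat.ListAction using (sum)
  open import Data.Nat.Tactic.RingSolver using (solve-∀)
  open import Data.List.Properties using (∷-injective; concatMap-map; map-concatMap)
  open import Data.List.Relation.Unary.All as All using (All; []; _∷_)
  open import Data.Product using (Σ; _×_)
  open import Relation.Nullary.Decidable using (dec-true; dec-false)
  open import Relation.Binary.PropositionalEquality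
    using (refl; cong; cong₂; sym; trans; module ≡-Reasoning)

  -- A composition of suc k is encoded by v : Vec Bool k, where v_i = true
  -- means that a part ends after the i-th cell.
  firstPart : {k : ℕ} → Vec Bool k → ℕ
  firstPart [] = 1
  firstPart (true ∷ v) = 1
  firstPart (false ∷ v) = suc (firstPart v)

  otherParts : {k : ℕ} → Vec Bool k → List ℕ
  otherParts [] = []
  otherParts (true ∷ v) = firstPart v ∷ otherParts v
  otherParts (false ∷ v) = otherParts v

  fromCuts : {k : ℕ} → Vec Bool k → List ℕ
  fromCuts v = firstPart v ∷ otherParts v

  allCuts : (k : ℕ) → List (Vec Bool k)
  allCuts zero = [] ∷ []
  allCuts (suc k) = concatMap (λ v → (true ∷ v) ∷ (false ∷ v) ∷ []) (allCuts k)

  #cuts : {k : ℕ} → Vec Bool k → ℕ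
  #cuts [] = 0
  #cuts (true ∷ v) = suc (#cuts v)
  #cuts (false ∷ v) = #cuts v

  cutPoints : {k : ℕ} → ℕ → Vec Bool k → List ℕ
  cutPoints o [] = []
  cutPoints o (true ∷ v) = suc o ∷ cutPoints (suc o) v
  cutPoints o (false ∷ v) = cutPoints (suc o) v

  partEnds : {k : ℕ} → ℕ → Vec Bool k → List ℕ
  partEnds o [] = suc o ∷ []
  partEnds o (true ∷ v) = suc o ∷ partEnds (suc o) v
  partEnds o (false ∷ v) = partEnds (suc o) v

  compositions-suc : (k : ℕ) → compositions (suc k) ≡ map fromCuts (allCuts k)
  compositions-suc zero = refl
  -- The extension step of compositions sends fromCuts v to
  -- fromCuts (true ∷ v) and fromCuts (false ∷ v) by computation.
  compositions-suc (suc k) = trans (cong (concatMap _) (compositions-suc k))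
    (trans (concatMap-map _ fromCuts (allCuts k))
           (sym (map-concatMap fromCuts _ (allCuts k))))

  fromCuts-surjective : (k : ℕ) (α : List ℕ) → IsComposition (suc k) α →
                        Σ (Vec Bool k) λ v → α ≡ fromCuts v
  fromCuts-surjective k [] (_ , ())
  fromCuts-surjective k (zero ∷ α) (() ∷ _ , _)
  fromCuts-surjective zero (1 ∷ []) _ = [] , refl
  fromCuts-surjective zero (1 ∷ a ∷ α) (_ ∷ s≤s _ ∷ _ , ())
  fromCuts-surjective zero (suc (suc a) ∷ α) (_ , ())
  fromCuts-surjective (suc k) (1 ∷ α) (_ ∷ pos , eq)
    with v , refl ← fromCuts-surjective k α (pos , suc-injective eq) = true ∷ v , refl
  fromCuts-surjective (suc k) (suc (suc a) ∷ α) (_ ∷ pos , eq)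
    with v , eq′ ← fromCuts-surjective k (suc a ∷ α) (s≤s z≤n ∷ pos , suc-injective eq)
    with eqHead , eqTail ← ∷-injective eq′ = false ∷ v , cong₂ _∷_ (cong suc eqHead) eqTail

  length-otherParts : {k : ℕ} (v : Vec Bool k) → length (otherParts v) ≡ #cuts v
  length-otherParts [] = refl
  length-otherParts (true ∷ v) = cong suc (length-otherParts v)
  length-otherParts (false ∷ v) = length-otherParts v

  sum-fromCuts : {k : ℕ} (v : Vec Bool k) → sum (fromCuts v) ≡ suc k
  sum-fromCuts [] = refl
  sum-fromCuts (true ∷ v) = cong suc (sum-fromCuts v)
  sum-fromCuts (false ∷ v) = cong suc (sum-fromCuts v)

  psumsFrom-fromCuts : {k : ℕ} (o : ℕ) (v : Vec Bool k) →
                       psumsFrom o (fromCuts v) ≡ partEnds o v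
  psumsFrom-fromCuts o [] rewrite ℕ.+-comm o 1 = refl
  psumsFrom-fromCuts o (true ∷ v) rewrite ℕ.+-comm o 1 =
    cong (suc o ∷_) (psumsFrom-fromCuts (suc o) v)
  psumsFrom-fromCuts o (false ∷ v) rewrite ℕ.+-suc o (firstPart v) = psumsFrom-fromCuts (suc o) v

  dropLast-∷-partEnds : {k : ℕ} (x o : ℕ) (v : Vec Bool k) →
                        dropLast (x ∷ partEnds o v) ≡ x ∷ cutPoints o v
  dropLast-∷-partEnds x o [] = refl
  dropLast-∷-partEnds x o (true ∷ v) = cong (x ∷_) (dropLast-∷-partEnds (suc o) (suc o) v)
  dropLast-∷-partEnds x o (false ∷ v) = dropLast-∷-partEnds x (suc o) v

  dropLast-partEnds : {k : ℕ} (o : ℕ) (v : Vec Bool k) →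
                      dropLast (partEnds o v) ≡ cutPoints o v
  dropLast-partEnds o [] = refl
  dropLast-partEnds o (true ∷ v) = dropLast-∷-partEnds (suc o) (suc o) v
  dropLast-partEnds o (false ∷ v) = dropLast-partEnds (suc o) v

  sub-fromCuts : {k : ℕ} (v : Vec Bool k) → sub (fromCuts v) ≡ cutPoints 0 v
  sub-fromCuts v = trans (cong dropLast (psumsFrom-fromCuts 0 v)) (dropLast-partEnds 0 v)

  _⊑ᵇ_ : {k : ℕ} → Vec Bool k → Vec Bool k → Bool
  [] ⊑ᵇ [] = true
  (true ∷ a) ⊑ᵇ (y ∷ b) = y ∧ (a ⊑ᵇ b)
  (false ∷ a) ⊑ᵇ (y ∷ b) = a ⊑ᵇ b

  -- In both statistics the counter c is one plus the number of cuts of the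
  -- middle argument passed so far: the index j of ξ(j) in g, and the index
  -- of the current part of the coarser composition in s.
  gCuts : {k : ℕ} → ℕ → Vec Bool k → Vec Bool k → ℕ
  gCuts c [] [] = 0
  gCuts c (x ∷ a) (true ∷ b) = (if x then 0 else c) + gCuts (suc c) a b
  gCuts c (x ∷ a) (false ∷ b) = gCuts c a b

  sCuts : {k : ℕ} → ℕ → Vec Bool k → Vec Bool k → ℕ
  sCuts c [] [] = 0
  sCuts c (true ∷ b) (y ∷ d) = sCuts (suc c) b d
  sCuts c (false ∷ b) (y ∷ d) = (if y then c else 0) + sCuts c b d

  ⊑ᵇ⇒#cuts≤ : {k : ℕ} (b d : Vec Bool k) → (b ⊑ᵇ d) ≡ true → #cuts b ≤ #cuts d
  ⊑ᵇ⇒#cuts≤ [] [] _ = z≤n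
  ⊑ᵇ⇒#cuts≤ (true ∷ b) (true ∷ d) b⊑d = s≤s (⊑ᵇ⇒#cuts≤ b d b⊑d)
  ⊑ᵇ⇒#cuts≤ (false ∷ b) (true ∷ d) b⊑d = m≤n⇒m≤1+n (⊑ᵇ⇒#cuts≤ b d b⊑d)
  ⊑ᵇ⇒#cuts≤ (false ∷ b) (false ∷ d) b⊑d = ⊑ᵇ⇒#cuts≤ b d b⊑d

  cutPoints-above : {k : ℕ} (o : ℕ) (v : Vec Bool k) → All (o <_) (cutPoints o v)
  cutPoints-above o [] = []
  cutPoints-above o (true ∷ v) =
    n<1+n o ∷ All.map (<-trans (n<1+n o)) (cutPoints-above (suc o) v)
  cutPoints-above o (false ∷ v) = All.map (<-trans (n<1+n o)) (cutPoints-above (suc o) v)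

  partEnds-above : {k : ℕ} (o : ℕ) (v : Vec Bool k) → All (o <_) (partEnds o v)
  partEnds-above o [] = n<1+n o ∷ []
  partEnds-above o (true ∷ v) =
    n<1+n o ∷ All.map (<-trans (n<1+n o)) (partEnds-above (suc o) v)
  partEnds-above o (false ∷ v) = All.map (<-trans (n<1+n o)) (partEnds-above (suc o) v)

  ∉ᵇ-above : (p : ℕ) (L : List ℕ) → All (p <_) L → (p ∈ᵇ L) ≡ false
  ∉ᵇ-above p [] [] = refl
  ∉ᵇ-above p (q ∷ L) (p<q ∷ p<L)
    rewrite dec-false (p ≟ q) (<⇒≢ p<q) = ∉ᵇ-above p L p<L

  ∈ᵇ-cutPoints-head : {k : ℕ} (o : ℕ) (x : Bool) (a : Vec Bool k) →
                      (suc o ∈ᵇ cutPoints o (x ∷ a)) ≡ x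
  ∈ᵇ-cutPoints-head o true a rewrite dec-true (suc o ≟ suc o) refl = refl
  ∈ᵇ-cutPoints-head o false a =
    ∉ᵇ-above (suc o) (cutPoints (suc o) a) (cutPoints-above (suc o) a)

  ∈ᵇ-cutPoints-tail : {k m : ℕ} (o : ℕ) (x : Bool) (a : Vec Bool k) (v : Vec Bool m) →
                      All (λ p → (p ∈ᵇ cutPoints o (x ∷ a)) ≡ (p ∈ᵇ cutPoints (suc o) a))
                          (cutPoints (suc o) v)
  ∈ᵇ-cutPoints-tail o true a v =
    All.map (λ {p} o<p → cong (_∨ (p ∈ᵇ cutPoints (suc o) a)) (dec-false (p ≟ suc o) (>⇒≢ o<p)))
            (cutPoints-above (suc o) v)
  ∈ᵇ-cutPoints-tail o false a v = All.universal (λ _ → refl) (cutPoints (suc o) v)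

  gAux-cong : (j : ℕ) (S S′ L : List ℕ) → All (λ p → (p ∈ᵇ S) ≡ (p ∈ᵇ S′)) L →
              gAux j S L ≡ gAux j S′ L
  gAux-cong j S S′ [] [] = refl
  gAux-cong j S S′ (p ∷ L) (eq ∷ eqs) =
    cong₂ _+_ (cong (if_then 0 else j) eq) (gAux-cong (suc j) S S′ L eqs)

  ⊆ᵇ-cong : (S S′ L : List ℕ) → All (λ p → (p ∈ᵇ S) ≡ (p ∈ᵇ S′)) L → (L ⊆ᵇ S) ≡ (L ⊆ᵇ S′)
  ⊆ᵇ-cong S S′ [] [] = refl
  ⊆ᵇ-cong S S′ (p ∷ L) (eq ∷ eqs) = cong₂ _∧_ eq (⊆ᵇ-cong S S′ L eqs)

  ⊆ᵇ-cutPoints : {k : ℕ} (o : ℕ) (a b : Vec Bool k) →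
                 (cutPoints o a ⊆ᵇ cutPoints o b) ≡ (a ⊑ᵇ b)
  ⊆ᵇ-cutPoints o [] [] = refl
  ⊆ᵇ-cutPoints o (true ∷ a) (y ∷ b) =
    cong₂ _∧_ (∈ᵇ-cutPoints-head o y b)
              (trans (⊆ᵇ-cong (cutPoints o (y ∷ b)) (cutPoints (suc o) b) _ (∈ᵇ-cutPoints-tail o y b a))
                     (⊆ᵇ-cutPoints (suc o) a b))
  ⊆ᵇ-cutPoints o (false ∷ a) (y ∷ b) =
    trans (⊆ᵇ-cong (cutPoints o (y ∷ b)) (cutPoints (suc o) b) _ (∈ᵇ-cutPoints-tail o y b a))
          (⊆ᵇ-cutPoints (suc o) a b)

  gAux-cutPoints : {k : ℕ} (j o : ℕ) (a b : Vec Bool k) →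
                   gAux j (cutPoints o a) (cutPoints o b) ≡ gCuts j a b
  gAux-cutPoints j o [] [] = refl
  gAux-cutPoints j o (x ∷ a) (true ∷ b) =
    cong₂ _+_ (cong (if_then 0 else j) (∈ᵇ-cutPoints-head o x a))
              (trans (gAux-cong _ _ _ _ (∈ᵇ-cutPoints-tail o x a b))
                     (gAux-cutPoints (suc j) (suc o) a b))
  gAux-cutPoints j o (x ∷ a) (false ∷ b) =
    trans (gAux-cong _ _ _ _ (∈ᵇ-cutPoints-tail o x a b)) (gAux-cutPoints j (suc o) a b)

  ⪰ᵇ-fromCuts : {k : ℕ} (a b : Vec Bool k) → (fromCuts b ⪰ᵇ fromCuts a) ≡ (a ⊑ᵇ b)
  ⪰ᵇ-fromCuts a b rewrite sub-fromCuts a | sub-fromCuts b = ⊆ᵇ-cutPoints 0 a b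

  g-fromCuts : {k : ℕ} (a b : Vec Bool k) → g (fromCuts a) (fromCuts b) ≡ gCuts 1 a b
  g-fromCuts a b rewrite sub-fromCuts a | sub-fromCuts b = gAux-cutPoints 1 0 a b

  count≤-∷ : (p q : ℕ) (P : List ℕ) → q ≤ p → count≤ p (q ∷ P) ≡ suc (count≤ p P)
  count≤-∷ p q P q≤p rewrite dec-true (q ≤? p) q≤p = refl

  count≤-below : (p : ℕ) (P : List ℕ) → All (p <_) P → count≤ p P ≡ 0
  count≤-below p [] [] = refl
  count≤-below p (q ∷ P) (p<q ∷ p<P)
    rewrite dec-false (q ≤? p) (<⇒≱ p<q) = count≤-below p P p<P

  count≤-∷-below : (p : ℕ) (P : List ℕ) → All (p <_) P → count≤ p (p ∷ P) ≡ 1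
  count≤-∷-below p P p<P = trans (count≤-∷ p p P ≤-refl) (cong suc (count≤-below p P p<P))

  m+[1+n]∸m∸1≡n : (m n : ℕ) → m + suc n ∸ m ∸ 1 ≡ n
  m+[1+n]∸m∸1≡n m n = cong (_∸ 1) (m+n∸m≡n m (suc n))

  -- Invariant of the computation of s: i is the count at the end of the previous
  -- part of b, and e cuts of d have already been passed inside the current part
  -- of b, which therefore contributes j e.
  sAux-partEnds : {k : ℕ} (j o i e : ℕ) (P : List ℕ) (b d : Vec Bool k) → (b ⊑ᵇ d) ≡ true →
                  All (λ p → count≤ p P ≡ i + (count≤ p (partEnds o d) + e)) (partEnds o b) →
                  sAux j i (partEnds o b) P ≡ j * e + sCuts j b d
  sAux-partEnds j o i e P [] [] _ (P≡ ∷ []) =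
    cong (λ z → j * z + 0) (trans (cong (λ x → x ∸ i ∸ 1) end) (m+[1+n]∸m∸1≡n i e))
    where
    end : count≤ (suc o) P ≡ i + suc e
    end = trans P≡ (cong (λ c → i + (c + e)) (count≤-∷-below (suc o) [] []))
  sAux-partEnds j o i e P (true ∷ b) (true ∷ d) b⊑d (P≡ ∷ P≡s) =
    cong₂ _+_ (cong (j *_) (trans (cong (λ x → x ∸ i ∸ 1) end) (m+[1+n]∸m∸1≡n i e)))
              (trans (sAux-partEnds (suc j) (suc o) _ 0 P b d b⊑d
                                    (All.zipWith restart (P≡s , partEnds-above (suc o) b)))
                     (cong (_+ sCuts (suc j) b d) (ℕ.*-zeroʳ (suc j))))
    where
    open ≡-Reasoning
    D = partEnds (suc o) d
    end : count≤ (suc o) P ≡ i + suc e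
    end = trans P≡ (cong (λ c → i + (c + e)) (count≤-∷-below (suc o) D (partEnds-above (suc o) d)))
    regroup : ∀ i c e → i + (suc c + e) ≡ i + suc e + (c + 0)
    regroup = solve-∀
    restart : ∀ {p} → count≤ p P ≡ i + (count≤ p (suc o ∷ D) + e) × suc o < p →
              count≤ p P ≡ count≤ (suc o) P + (count≤ p D + 0)
    restart {p} (P≡′ , o<p) = begin
      count≤ p P                         ≡⟨ P≡′ ⟩
      i + (count≤ p (suc o ∷ D) + e)     ≡⟨ cong (λ c → i + (c + e)) (count≤-∷ p (suc o) D (<⇒≤ o<p)) ⟩
      i + (suc (count≤ p D) + e)         ≡⟨ regroup i (count≤ p D) e ⟩
      i + suc e + (count≤ p D + 0)       ≡⟨ cong (_+ (count≤ p D + 0)) end ⟨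
      count≤ (suc o) P + (count≤ p D + 0) ∎
  sAux-partEnds j o i e P (false ∷ b) (true ∷ d) b⊑d P≡s =
    trans (sAux-partEnds j (suc o) i (suc e) P b d b⊑d
                         (All.zipWith shift (P≡s , partEnds-above (suc o) b)))
          (regroup j e (sCuts j b d))
    where
    open ≡-Reasoning
    D = partEnds (suc o) d
    regroup : ∀ j e x → j * suc e + x ≡ j * e + (j + x)
    regroup = solve-∀
    shift : ∀ {p} → count≤ p P ≡ i + (count≤ p (suc o ∷ D) + e) × suc o < p →
            count≤ p P ≡ i + (count≤ p D + suc e)
    shift {p} (P≡′ , o<p) = begin
      count≤ p P                     ≡⟨ P≡′ ⟩
      i + (count≤ p (suc o ∷ D) + e) ≡⟨ cong (λ c → i + (c + e)) (count≤-∷ p (suc o) D (<⇒≤ o<p)) ⟩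
      i + (suc (count≤ p D) + e)     ≡⟨ cong (i +_) (ℕ.+-suc (count≤ p D) e) ⟨
      i + (count≤ p D + suc e)       ∎
  sAux-partEnds j o i e P (false ∷ b) (false ∷ d) b⊑d P≡s = sAux-partEnds j (suc o) i e P b d b⊑d P≡s

  s-fromCuts : {k : ℕ} (b d : Vec Bool k) → (b ⊑ᵇ d) ≡ true →
               s (fromCuts b) (fromCuts d) ≡ sCuts 1 b d
  s-fromCuts b d b⊑d =
    trans (cong₂ (sAux 1 0) (psumsFrom-fromCuts 0 b) (psumsFrom-fromCuts 0 d))
          (sAux-partEnds 1 0 0 0 (partEnds 0 d) b d b⊑d
                         (All.universal (λ p → sym (ℕ.+-identityʳ _)) (partEnds 0 b)))

open Cuts

module Sums {c ℓ : Level} (R : CommutativeRing c ℓ) where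

  open import Data.List.Properties using (map-∘)
  open import Relation.Binary.PropositionalEquality using (cong)
  import Algebra.Properties.CommutativeSemigroup as CommutativeSemigroupProperties
  import Relation.Binary.Reasoning.Setoid as SetoidReasoning
  open CommutativeRing R renaming (_+_ to _⊕_; _*_ to _⊗_)
  open Poly R
  open CommutativeSemigroupProperties +-commutativeSemigroup using (interchange)
  open SetoidReasoning setoid

  private variable
    A B : Set

  Σ-cong : (L : List A) {f h : A → Carrier} → (∀ a → f a ≈ h a) →
           Σ[ map f L ] ≈ Σ[ map h L ]
  Σ-cong [] f≈h = refl
  Σ-cong (a ∷ L) f≈h = +-cong (f≈h a) (Σ-cong L f≈h)

  Σ-filterᵇ : (L : List A) (p : A → Bool) (f : A → Carrier) →
              Σ[ map f (filterᵇ p L) ] ≈ Σ[ map (λ a → if p a then f a else 0#) L ]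
  Σ-filterᵇ [] p f = refl
  Σ-filterᵇ (a ∷ L) p f with p a
  ... | true = +-cong refl (Σ-filterᵇ L p f)
  ... | false = trans (Σ-filterᵇ L p f) (sym (+-identityˡ _))

  Σ-zero : (L : List A) → Σ[ map (λ _ → 0#) L ] ≈ 0#
  Σ-zero [] = refl
  Σ-zero (a ∷ L) = trans (+-identityˡ _) (Σ-zero L)

  Σ-+ : (L : List A) (f h : A → Carrier) →
        Σ[ map (λ a → f a ⊕ h a) L ] ≈ Σ[ map f L ] ⊕ Σ[ map h L ]
  Σ-+ [] f h = sym (+-identityˡ 0#)
  Σ-+ (a ∷ L) f h = trans (+-cong refl (Σ-+ L f h)) (interchange _ _ _ _)

  Σ-*ˡ : (L : List A) (y : Carrier) (f : A → Carrier) →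
         Σ[ map (λ a → y ⊗ f a) L ] ≈ y ⊗ Σ[ map f L ]
  Σ-*ˡ [] y f = sym (zeroʳ y)
  Σ-*ˡ (a ∷ L) y f = trans (+-cong refl (Σ-*ˡ L y f)) (sym (distribˡ y _ _))

  Σ-*ʳ : (L : List A) (y : Carrier) (f : A → Carrier) →
         Σ[ map (λ a → f a ⊗ y) L ] ≈ Σ[ map f L ] ⊗ y
  Σ-*ʳ [] y f = sym (zeroˡ y)
  Σ-*ʳ (a ∷ L) y f = trans (+-cong refl (Σ-*ʳ L y f)) (sym (distribʳ y _ _))

  Σ-swap : (L : List A) (M : List B) (f : A → B → Carrier) →
           Σ[ map (λ a → Σ[ map (f a) M ]) L ] ≈ Σ[ map (λ b → Σ[ map (λ a → f a b) L ]) M ]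
  Σ-swap [] M f = sym (Σ-zero M)
  Σ-swap (a ∷ L) M f =
    trans (+-cong refl (Σ-swap L M f)) (sym (Σ-+ M (f a) (λ b → Σ[ map (λ a → f a b) L ])))

  Σ-*-Σ-assoc : (L : List A) (M : List B)
                (u : A → Carrier) (w : A → B → Carrier) (f : B → Carrier) →
                Σ[ map (λ a → u a ⊗ Σ[ map (λ b → w a b ⊗ f b) M ]) L ]
                  ≈ Σ[ map (λ b → Σ[ map (λ a → u a ⊗ w a b) L ] ⊗ f b) M ]
  Σ-*-Σ-assoc L M u w f = begin
    Σ[ map (λ a → u a ⊗ Σ[ map (λ b → w a b ⊗ f b) M ]) L ]
      ≈⟨ Σ-cong L (λ a → trans (Σ-cong M (λ b → *-assoc _ _ _)) (Σ-*ˡ M (u a) _)) ⟨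
    Σ[ map (λ a → Σ[ map (λ b → u a ⊗ w a b ⊗ f b) M ]) L ]
      ≈⟨ Σ-swap L M (λ a b → u a ⊗ w a b ⊗ f b) ⟩
    Σ[ map (λ b → Σ[ map (λ a → u a ⊗ w a b ⊗ f b) L ]) M ]
      ≈⟨ Σ-cong M (λ b → Σ-*ʳ L (f b) (λ a → u a ⊗ w a b)) ⟩
    Σ[ map (λ b → Σ[ map (λ a → u a ⊗ w a b) L ] ⊗ f b) M ] ∎

  Σ-pairs : {k : ℕ} (L : List (Vec Bool k)) (f : Vec Bool (suc k) → Carrier) →
            Σ[ map f (concatMap (λ v → (true ∷ v) ∷ (false ∷ v) ∷ []) L) ]
              ≈ Σ[ map (λ v → f (true ∷ v) ⊕ f (false ∷ v)) L ]
  Σ-pairs [] f = refl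
  Σ-pairs (v ∷ L) f = trans (+-cong refl (+-cong refl (Σ-pairs L f))) (sym (+-assoc _ _ _))

  Σ-filter-compositions : (k : ℕ) (p : List ℕ → Bool) (f : List ℕ → Carrier) →
    Σ[ map f (filterᵇ p (compositions (suc k))) ]
      ≈ Σ[ map (λ v → if p (fromCuts v) then f (fromCuts v) else 0#) (allCuts k) ]
  Σ-filter-compositions k p f = begin
    Σ[ map f (filterᵇ p (compositions (suc k))) ]
      ≡⟨ cong (λ L → Σ[ map f (filterᵇ p L) ]) (compositions-suc k) ⟩
    Σ[ map f (filterᵇ p (map fromCuts (allCuts k))) ]
      ≈⟨ Σ-filterᵇ (map fromCuts (allCuts k)) p f ⟩
    Σ[ map (λ β → if p β then f β else 0#) (map fromCuts (allCuts k)) ]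
      ≡⟨ cong Σ[_] (map-∘ (allCuts k)) ⟨
    Σ[ map (λ v → if p (fromCuts v) then f (fromCuts v) else 0#) (allCuts k) ] ∎

module Expansion {c ℓ : Level} (R : CommutativeRing c ℓ) (t : CommutativeRing.Carrier R) where

  open import Data.Nat.Properties using (+-∸-assoc)
  open import Relation.Binary.PropositionalEquality using (cong)
  open import Algebra.Properties.Ring (CommutativeRing.ring R) using (-‿distribˡ-*)
  import Algebra.Properties.CommutativeSemigroup as CommutativeSemigroupProperties
  import Relation.Binary.Reasoning.Setoid as SetoidReasoning
  open CommutativeRing R renaming (_+_ to _⊕_; _*_ to _⊗_)
  open Poly R
  open Sums R
  open CommutativeSemigroupProperties *-commutativeSemigroup using (x∙yz≈y∙xz)
  open SetoidReasoning setoid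

  pow-+ : (y : Carrier) (m n : ℕ) → pow y (m + n) ≈ pow y m ⊗ pow y n
  pow-+ y zero n = sym (*-identityˡ _)
  pow-+ y (suc m) n = trans (*-cong refl (pow-+ y m n)) (sym (*-assoc _ _ _))

  if-⊗ : (p : Bool) (y z : Carrier) → (if p then y else 0#) ⊗ z ≈ (if p then y ⊗ z else 0#)
  if-⊗ true y z = refl
  if-⊗ false y z = zeroˡ z

  gWeight : {k : ℕ} → ℕ → Vec Bool k → Vec Bool k → Carrier
  gWeight c a b = if a ⊑ᵇ b then pow t (gCuts c a b) else 0#

  sWeight : {k : ℕ} → ℕ → Vec Bool k → Vec Bool k → Carrier
  sWeight c b d = if b ⊑ᵇ d then sign (#cuts d ∸ #cuts b) ⊗ pow t (sCuts c b d) else 0#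

  δ : {k : ℕ} → Vec Bool k → Vec Bool k → Carrier
  δ [] [] = 1#
  δ (true ∷ a) (true ∷ d) = δ a d
  δ (false ∷ a) (false ∷ d) = δ a d
  δ (true ∷ a) (false ∷ d) = 0#
  δ (false ∷ a) (true ∷ d) = 0#

  gWeight-cut : {k : ℕ} (c : ℕ) (a b : Vec Bool k) →
                gWeight c (false ∷ a) (true ∷ b) ≈ pow t c ⊗ gWeight (suc c) a b
  gWeight-cut c a b with a ⊑ᵇ b
  ... | true = pow-+ t c _
  ... | false = sym (zeroʳ _)

  sWeight-cut : {k : ℕ} (c : ℕ) (b d : Vec Bool k) →
                sWeight c (false ∷ b) (true ∷ d) ≈ (- pow t c) ⊗ sWeight c b d
  sWeight-cut c b d with b ⊑ᵇ d in b⊑d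
  ... | false = sym (zeroʳ _)
  ... | true rewrite +-∸-assoc 1 (⊑ᵇ⇒#cuts≤ b d b⊑d) = begin
    (- σ) ⊗ pow t (c + sCuts c b d)      ≈⟨ *-cong refl (pow-+ t c _) ⟩
    (- σ) ⊗ (pow t c ⊗ pow t (sCuts c b d)) ≈⟨ -‿distribˡ-* σ _ ⟨
    - (σ ⊗ (pow t c ⊗ pow t (sCuts c b d))) ≈⟨ -‿cong (x∙yz≈y∙xz _ _ _) ⟩
    - (pow t c ⊗ (σ ⊗ pow t (sCuts c b d))) ≈⟨ -‿distribˡ-* (pow t c) _ ⟩
    (- pow t c) ⊗ (σ ⊗ pow t (sCuts c b d)) ∎
    where σ = sign (#cuts d ∸ #cuts b)

  Σ-gWeight*sWeight≈δ : (k c : ℕ) (a d : Vec Bool k) →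
                      Σ[ map (λ b → gWeight c a b ⊗ sWeight c b d) (allCuts k) ] ≈ δ a d
  Σ-gWeight*sWeight≈δ zero c [] [] =
    trans (+-identityʳ _) (trans (*-identityˡ _) (*-identityˡ _))
  Σ-gWeight*sWeight≈δ (suc k) c (true ∷ a) (true ∷ d) =
    trans (Σ-pairs (allCuts k) _)
          (trans (Σ-cong (allCuts k) (λ b → trans (+-cong refl (zeroˡ _)) (+-identityʳ _)))
                 (Σ-gWeight*sWeight≈δ k (suc c) a d))
  Σ-gWeight*sWeight≈δ (suc k) c (false ∷ a) (false ∷ d) =
    trans (Σ-pairs (allCuts k) _)
          (trans (Σ-cong (allCuts k) (λ b → trans (+-cong (zeroʳ _) refl) (+-identityˡ _)))
                 (Σ-gWeight*sWeight≈δ k c a d))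
  Σ-gWeight*sWeight≈δ (suc k) c (true ∷ a) (false ∷ d) =
    trans (Σ-pairs (allCuts k) _)
          (trans (Σ-cong (allCuts k) (λ b → trans (+-cong (zeroʳ _) (zeroˡ _)) (+-identityˡ _)))
                 (Σ-zero (allCuts k)))
  Σ-gWeight*sWeight≈δ (suc k) c (false ∷ a) (true ∷ d) = begin
    Σ[ map W (allCuts (suc k)) ]
      ≈⟨ Σ-pairs (allCuts k) W ⟩
    Σ[ map (λ b → W (true ∷ b) ⊕ W (false ∷ b)) (allCuts k) ]
      ≈⟨ Σ-cong (allCuts k) (λ b → +-cong (split-cut b) (split-no-cut b)) ⟩
    Σ[ map (λ b → p ⊗ W₊ b ⊕ (- p) ⊗ W₀ b) (allCuts k) ]
      ≈⟨ Σ-+ (allCuts k) _ _ ⟩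
    Σ[ map (λ b → p ⊗ W₊ b) (allCuts k) ] ⊕ Σ[ map (λ b → (- p) ⊗ W₀ b) (allCuts k) ]
      ≈⟨ +-cong (Σ-*ˡ (allCuts k) p W₊) (Σ-*ˡ (allCuts k) (- p) W₀) ⟩
    p ⊗ Σ[ map W₊ (allCuts k) ] ⊕ (- p) ⊗ Σ[ map W₀ (allCuts k) ]
      ≈⟨ +-cong (*-cong refl (Σ-gWeight*sWeight≈δ k (suc c) a d))
                (*-cong refl (Σ-gWeight*sWeight≈δ k c a d)) ⟩
    p ⊗ δ a d ⊕ (- p) ⊗ δ a d
      ≈⟨ distribʳ (δ a d) p (- p) ⟨
    (p ⊕ - p) ⊗ δ a d
      ≈⟨ *-cong (-‿inverseʳ p) refl ⟩
    0# ⊗ δ a d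
      ≈⟨ zeroˡ _ ⟩
    0# ∎
    where
    p = pow t c
    W = λ b → gWeight c (false ∷ a) b ⊗ sWeight c b (true ∷ d)
    W₊ = λ b → gWeight (suc c) a b ⊗ sWeight (suc c) b d
    W₀ = λ b → gWeight c a b ⊗ sWeight c b d
    split-cut : ∀ b → W (true ∷ b) ≈ p ⊗ W₊ b
    split-cut b = trans (*-cong (gWeight-cut c a b) refl) (*-assoc _ _ _)
    split-no-cut : ∀ b → W (false ∷ b) ≈ (- p) ⊗ W₀ b
    split-no-cut b = trans (*-cong refl (sWeight-cut c b d)) (x∙yz≈y∙xz _ _ _)

  Σ-δ* : (k : ℕ) (a : Vec Bool k) (f : Vec Bool k → Carrier) →
         Σ[ map (λ d → δ a d ⊗ f d) (allCuts k) ] ≈ f a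
  Σ-δ* zero [] f = trans (+-identityʳ _) (*-identityˡ _)
  Σ-δ* (suc k) (true ∷ a) f =
    trans (Σ-pairs (allCuts k) _)
          (trans (Σ-cong (allCuts k) (λ d → trans (+-cong refl (zeroˡ _)) (+-identityʳ _)))
                 (Σ-δ* k a (λ d → f (true ∷ d))))
  Σ-δ* (suc k) (false ∷ a) f =
    trans (Σ-pairs (allCuts k) _)
          (trans (Σ-cong (allCuts k) (λ d → trans (+-cong (zeroˡ _) refl) (+-identityˡ _)))
                 (Σ-δ* k a (λ d → f (false ∷ d))))

  module _ (N : ℕ) (x : Fin N → Carrier) where

    G-fromCuts : {k : ℕ} (b : Vec Bool k) →
                 G N (fromCuts b) x t
                   ≈ Σ[ map (λ d → sWeight 1 b d ⊗ F N (fromCuts d) x) (allCuts k) ]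
    G-fromCuts {k} b = begin
      G N (fromCuts b) x t
        ≡⟨ cong (λ n → Σ[ map term (filterᵇ (_⪰ᵇ fromCuts b) (compositions n)) ]) (sum-fromCuts b) ⟩
      Σ[ map term (filterᵇ (_⪰ᵇ fromCuts b) (compositions (suc k))) ]
        ≈⟨ Σ-filter-compositions k (_⪰ᵇ fromCuts b) term ⟩
      Σ[ map (λ d → if fromCuts d ⪰ᵇ fromCuts b then term (fromCuts d) else 0#) (allCuts k) ]
        ≈⟨ Σ-cong (allCuts k) coefficient ⟩
      Σ[ map (λ d → sWeight 1 b d ⊗ F N (fromCuts d) x) (allCuts k) ] ∎
      where
      term : List ℕ → Carrier
      term γ = sign (length γ ∸ length (fromCuts b)) ⊗ (pow t (s (fromCuts b) γ) ⊗ F N γ x)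
      coefficient : (d : Vec Bool k) →
        (if fromCuts d ⪰ᵇ fromCuts b then term (fromCuts d) else 0#)
          ≈ sWeight 1 b d ⊗ F N (fromCuts d) x
      coefficient d rewrite ⪰ᵇ-fromCuts b d with b ⊑ᵇ d in b⊑d
      ... | true rewrite length-otherParts b | length-otherParts d | s-fromCuts b d b⊑d =
        sym (*-assoc _ _ _)
      ... | false = sym (zeroˡ _)

    F-fromCuts-expansion : {k : ℕ} (a : Vec Bool k) →
      F N (fromCuts a) x ≈ Σ[ map (λ β → pow t (g (fromCuts a) β) ⊗ G N β x t)
                                  (filterᵇ (_⪰ᵇ fromCuts a) (compositions (suc k))) ]
    F-fromCuts-expansion {k} a = sym (begin
      Σ[ map term (filterᵇ (_⪰ᵇ fromCuts a) (compositions (suc k))) ]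
        ≈⟨ Σ-filter-compositions k (_⪰ᵇ fromCuts a) term ⟩
      Σ[ map (λ b → if fromCuts b ⪰ᵇ fromCuts a then term (fromCuts b) else 0#) (allCuts k) ]
        ≈⟨ Σ-cong (allCuts k) coefficient ⟩
      Σ[ map (λ b → gWeight 1 a b ⊗ G N (fromCuts b) x t) (allCuts k) ]
        ≈⟨ Σ-cong (allCuts k) (λ b → *-cong refl (G-fromCuts b)) ⟩
      Σ[ map (λ b → gWeight 1 a b ⊗ Σ[ map (λ d → sWeight 1 b d ⊗ Fd d) (allCuts k) ]) (allCuts k) ]
        ≈⟨ Σ-*-Σ-assoc (allCuts k) (allCuts k) (gWeight 1 a) (sWeight 1) Fd ⟩
      Σ[ map (λ d → Σ[ map (λ b → gWeight 1 a b ⊗ sWeight 1 b d) (allCuts k) ] ⊗ Fd d) (allCuts k) ]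
        ≈⟨ Σ-cong (allCuts k) (λ d → *-cong (Σ-gWeight*sWeight≈δ k 1 a d) refl) ⟩
      Σ[ map (λ d → δ a d ⊗ Fd d) (allCuts k) ]
        ≈⟨ Σ-δ* k a Fd ⟩
      Fd a ∎)
      where
      Fd : Vec Bool k → Carrier
      Fd d = F N (fromCuts d) x
      term : List ℕ → Carrier
      term β = pow t (g (fromCuts a) β) ⊗ G N β x t
      coefficient : (b : Vec Bool k) →
        (if fromCuts b ⪰ᵇ fromCuts a then term (fromCuts b) else 0#)
          ≈ gWeight 1 a b ⊗ G N (fromCuts b) x t
      coefficient b rewrite ⪰ᵇ-fromCuts a b | g-fromCuts a b = sym (if-⊗ (a ⊑ᵇ b) _ _)

    F-empty-expansion : F N [] x ≈ Σ[ map (λ β → pow t (g [] β) ⊗ G N β x t)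
                                          (filterᵇ (_⪰ᵇ []) (compositions 0)) ]
    F-empty-expansion =
      sym (trans (+-identityʳ _)
          (trans (*-identityˡ _) (trans (+-identityʳ _) (trans (*-identityˡ _) (*-identityˡ _)))))

theorem5p1 : {c ℓ : Level} (R : CommutativeRing c ℓ) (n N : ℕ) (α : List ℕ)
             → IsComposition n α → n ≤ N
             → (x : Fin N → CommutativeRing.Carrier R) (t : CommutativeRing.Carrier R)
             → CommutativeRing._≈_ R (Poly.F R N α x)
                 (Poly.Σ[_] R (map (λ β → CommutativeRing._*_ R (Poly.pow R t (g α β)) (Poly.G R N β x t))
                                   (filterᵇ (_⪰ᵇ α) (compositions n))))
theorem5p1 R zero N [] _ _ x t = Expansion.F-empty-expansion R t N x
theorem5p1 R zero N (zero ∷ α) (() ∷ _ , _) _ x t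
theorem5p1 R zero N (suc a ∷ α) (_ , ()) _ x t
theorem5p1 R (suc k) N α α⊨n _ x t with v , ≡.refl ← fromCuts-surjective k α α⊨n =
  Expansion.F-fromCuts-expansion R t N x v
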